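{- For every $k\ge 3$, the extended wheel graph $XW_{2k}$ has book thickness exactly four.
   Context: For $k\ge 3$, the extended wheel graph $XW_{2k}$ is the graph on $n=2k+2$ vertices consisting of a cycle $C=v_1,\ldots,v_{2k}$ and two poles $p,q$, with edges: the cycle edges $\{v_i,v_{i+1}\}$; $\{p,v_i\}$ and $\{q,v_i\}$ for all $i=1,\ldots,2k$; and $\{v_i,v_{i+2}\}$ for $i=1,\ldots,2k$, indices taken so that $v_{2k+1}=v_1$, $v_{2k+2}=v_2$; there is no edge $\{p,q\}$. It is a 1-planar graph (drawable with each edge crossed at most once) with $4n-8$ edges, in a drawing where the cycle edges are uncrossed. The book thickness of a graph is the minimum $k'$ such that it has a $k'$-page book embedding: a linear ordering of the vertices together with an assignment of edges to $k'$ pages such that no two edges $\{u,v\}$, $\{x,y\}$ (with $u<v$, $x<y$) on the same page satisfy $u<x<v<y$ or $x<u<y<v$. -}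

module Defs where

open import Data.Nat using (ℕ; zero; suc; _+_; _*_; _∸_; _<_; _≤_)
open import Data.Fin using (Fin; toℕ)
open import Data.Sum using (_⊎_)
open import Data.Product using (Σ; _×_)
open import Relation.Binary.PropositionalEquality using (_≡_)
open import Relation.Nullary using (¬_)
open import Function.Definitions using (Injective)

-- A (simple, undirected) graph on the vertex set Fin n, given by its
-- adjacency relation (assumed symmetric by construction below).
Graph : ℕ → Set₁
Graph n = Fin n → Fin n → Set

-- Directed "generating" edges of XW_{2k}, on vertex labels in ℕ:
--   v_1 .. v_{2k}  ↦  0 .. 2k-1,   p ↦ 2k,   q ↦ 2k+1.
data XWDir (k : ℕ) : ℕ → ℕ → Set where
  cyc     : ∀ {i} → suc i < 2 * k → XWDir k i (suc i)
  cycWrap : XWDir k (2 * k ∸ 1) 0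
  chd     : ∀ {i} → 2 + i < 2 * k → XWDir k i (2 + i)
  chdWrap₁ : XWDir k (2 * k ∸ 2) 0
  chdWrap₂ : XWDir k (2 * k ∸ 1) 1
  poleP   : ∀ {i} → i < 2 * k → XWDir k i (2 * k)
  poleQ   : ∀ {i} → i < 2 * k → XWDir k i (suc (2 * k))

XW : (k : ℕ) → Graph (2 * k + 2)
XW k u v = XWDir k (toℕ u) (toℕ v) ⊎ XWDir k (toℕ v) (toℕ u)

-- A book embedding of G with t pages: a linear ordering of the vertices
-- (an injective position map into ℕ) and an assignment of pages to edges
-- (a symmetric page function on vertex pairs, only relevant on edges) such
-- that no two edges on the same page cross.  Quantifying over all ordered
-- vertex pairs covers both crossing patterns u<x<v<y and x<u<y<v.
record BookEmbedding {n : ℕ} (G : Graph n) (t : ℕ) : Set where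
  field
    pos     : Fin n → ℕ
    pos-inj : Injective _≡_ _≡_ pos
    page    : Fin n → Fin n → Fin t
    page-sym : ∀ u v → page u v ≡ page v u
    noCross : ∀ u v x y → G u v → G x y → page u v ≡ page x y →
              ¬ (pos u < pos x × pos x < pos v × pos v < pos y)

BookThickness : {n : ℕ} → Graph n → ℕ → Set
BookThickness G t = BookEmbedding G t × (∀ s → BookEmbedding G s → t ≤ s)

-- Upper bound: put the spine in the order q, v₁, …, v₂ₖ, p.  The rim edges together with the
-- q-spokes form a fan on one page, the p-spokes all end at the last spine vertex and fill a second
-- page, and the chords vᵢvᵢ₊₂ split by the parity of i into two families of non-crossing intervals
-- of length two, which also leave room for the wrap-around edges v₂ₖv₁, v₂ₖ₋₁v₁ and v₂ₖv₂.
--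
-- Lower bound: a t-page book embedding of a graph on n ≥ 3 vertices has at most (t+1)n − 3t edges,
-- i.e. 4n − 9 for three pages, while XW₂ₖ has 4n − 8.  The bound is an injective coding of edges by
-- pairs (slot, vertex) with t+1 slots.  An edge whose ends are consecutive on the spine is coded by
-- its left end in slot 0, the edge joining the two extreme spine vertices (if any) by the right
-- extreme in slot 0, and any other edge e on page c, in slot c+1, by a vertex strictly inside e that
-- no other page-c edge nested in e covers.  Two such edges with the same code would have to cross or
-- be nested, so the coding is injective; and in each slot c+1 the two extreme vertices and the
-- vertex exposed under the extreme edge stay unused.

module Submission where

open import Data.Bool using (true; false; if_then_else_; _∧_)
open import Data.Empty using (⊥-elim)
open import Data.Fin using (Fin; zero; suc; _≟_; inject≤; toℕ; fromℕ<; remQuot)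
open import Data.Fin.Patterns using (0F; 1F; 2F; 3F)
open import Data.Fin.Properties
  using (any?; injective⇒≤; +↔⊎; *↔×; inject≤-injective; toℕ-injective; toℕ-fromℕ<; toℕ<n)
  renaming (suc-injective to Fin-suc-injective)
open import Data.List using (List; filter; allFin)
open import Data.List.Extrema.Nat
  using (argmin; argmax; argmin-all; argmax-all; argmax-sel; f[argmin]≤f[xs]; f[xs]≤f[argmax])
open import Data.List.Membership.Propositional.Properties using (∈-allFin; ∈-filter⁺; ∈-filter⁻)
open import Data.List.Relation.Unary.All as All using (All)
open import Data.List.Relation.Unary.All.Properties using (all-filter)
open import Data.Nat
  using (ℕ; suc; _+_; _*_; _∸_; _⊓_; _⊔_; _<_; _≤_; _<?_; _≤?_; _≡ᵇ_; s≤s; z≤n; parity)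
open import Data.Nat.Properties
  using ( suc-injective; 0≢1+n; m<n⇒m<1+n; 1+n≰n; +-comm; +-cancelˡ-≤; *-distribˡ-+; *-monoʳ-≤
        ; ≤-refl; ≤-reflexive; ≤-trans; ≤-pred; ≤-antisym; ≤-total; <-trans; ≤-<-trans; <-≤-trans
        ; <-irrefl; <-asym; <-cmp; <⇒≤; <⇒≱; <⇒≢; >⇒≢; ≮⇒≥; ≰⇒>; ≤∧≢⇒<; n≤1+n; n<1+n; m<n⇒m≤1+n
        ; m+[n∸m]≡n; ∸-monoˡ-≤; ⊓-comm; ⊔-comm; m≤n⇒m⊓n≡m; m≤n⇒m⊔n≡n; m≥n⇒m⊓n≡n; m≥n⇒m⊔n≡m )
  renaming (_≟_ to _≟ℕ_)
open import Data.Parity.Base using (Parity; 0ℙ; 1ℙ; _⁻¹)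
open import Data.Parity.Properties using (p≢p⁻¹; suc-homo-⁻¹; *-homo-*)
open import Data.Product using (Σ; ∃; _×_; _,_; proj₁; proj₂; uncurry)
open import Data.Sum using (_⊎_; inj₁; inj₂; swap)
open import Data.Sum.Function.Propositional using (_⊎-↔_)
open import Function using (_∘_; _↔_; _↣_; Injection; mk↣)
open import Function.Construct.Composition using (_↣-∘_; _↔-∘_)
open import Function.Construct.Identity using (↔-id)
open import Function.Definitions using (Injective)
open import Function.Properties.Inverse using (↔⇒↣; ↔-sym)
open import Relation.Binary using (Symmetric; tri<; tri≈; tri>)
open import Relation.Binary.PropositionalEquality
open import Relation.Nullary using (¬_; Dec; yes; no)
open import Relation.Nullary.Decidable using (_×-dec_; dec-true; dec-false)

open import Defs

↣⇒≤ : ∀ {A B : Set} {a b : ℕ} → Fin a ↔ A → B ↔ Fin b → A ↣ B → a ≤ b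
↣⇒≤ A↔ B↔ f = injective⇒≤ (Injection.injective (↔⇒↣ B↔ ↣-∘ (f ↣-∘ ↔⇒↣ A↔)))

module NoncrossingEdgeBound
  {n′ t m : ℕ} (pos : Fin (3 + n′) → ℕ) (pos-injective : Injective _≡_ _≡_ pos)
  (lo hi : Fin m → Fin (3 + n′)) (lo<hi : ∀ e → pos (lo e) < pos (hi e))
  (ends-injective : ∀ e f → lo e ≡ lo f → hi e ≡ hi f → e ≡ f)
  (page : Fin m → Fin t)
  (noncrossing : ∀ e f → page e ≡ page f →
     ¬ (pos (lo e) < pos (lo f) × pos (lo f) < pos (hi e) × pos (hi e) < pos (hi f)))
  where

  V : Set
  V = Fin (3 + n′)

  infix 4 _≺_ _≼_
  _≺_ _≼_ : V → V → Set
  u ≺ v = pos u < pos v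
  u ≼ v = pos u ≤ pos v

  ≼∧≢⇒≺ : ∀ {u v} → u ≼ v → u ≢ v → u ≺ v
  ≼∧≢⇒≺ u≼v u≢v = ≤∧≢⇒< u≼v (u≢v ∘ pos-injective)

  Inside : V → V → V → Set
  Inside a b w = a ≺ w × w ≺ b

  Nested : Fin m → V → V → Set
  Nested e a b = a ≼ lo e × hi e ≼ b

  Exposed : Fin t → V → V → V → Set
  Exposed c a b x = Inside a b x ×
    (∀ e → page e ≡ c → Nested e a b → ¬ (lo e ≡ a × hi e ≡ b) → ¬ Inside (lo e) (hi e) x)

  vertices : List V
  vertices = allFin _

  -- Opaque because the normal forms of argmin and argmax over allFin are exponential.
  opaque
    next : V → V → V
    next a b = argmin pos b (filter (λ w → pos a <? pos w) vertices)

    next-≼ : ∀ {a b v} → a ≺ v → next a b ≼ v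
    next-≼ {a} {b} {v} a≺v =
      All.lookup (f[argmin]≤f[xs] b _) (∈-filter⁺ (λ w → pos a <? pos w) (∈-allFin v) a≺v)

    next-inside : ∀ {a b w} → Inside a b w → Inside a b (next a b)
    next-inside {a} {b} (a≺w , w≺b) =
      argmin-all pos (<-trans a≺w w≺b) (all-filter (λ w → pos a <? pos w) vertices) ,
      ≤-<-trans (next-≼ a≺w) w≺b

  FanEnd : Fin t → V → V → V → Set
  FanEnd c a b w = w ≺ b × ∃ λ e → page e ≡ c × lo e ≡ a × hi e ≡ w

  fanEnd? : ∀ c a b w → Dec (FanEnd c a b w)
  fanEnd? c a b w =
    (pos w <? pos b) ×-dec any? (λ e → (page e ≟ c) ×-dec (lo e ≟ a) ×-dec (hi e ≟ w))

  opaque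
    farthest : Fin t → V → V → V
    farthest c a b = argmax pos (next a b) (filter (fanEnd? c a b) vertices)

    farthest-inside : ∀ c {a b w} → Inside a b w → Inside a b (farthest c a b)
    farthest-inside c {a} {b} w-in =
      argmax-all pos (next-inside w-in) (All.map fanEnd-inside (all-filter (fanEnd? c a b) vertices))
      where
      fanEnd-inside : ∀ {w} → FanEnd c a b w → Inside a b w
      fanEnd-inside (w≺b , e , _ , refl , refl) = lo<hi e , w≺b

    ≼-farthest : ∀ {c a b} e → page e ≡ c → lo e ≡ a → hi e ≺ b → hi e ≼ farthest c a b
    ≼-farthest {c} {a} {b} e pe lo≡a hi≺b = All.lookup (f[xs]≤f[argmax] {f = pos} (next a b) _)
      (∈-filter⁺ (fanEnd? c a b) (∈-allFin (hi e)) (hi≺b , e , pe , lo≡a , refl))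

    farthest-sel : ∀ c a b → farthest c a b ≡ next a b ⊎ FanEnd c a b (farthest c a b)
    farthest-sel c a b with argmax-sel pos (next a b) (filter (fanEnd? c a b) vertices)
    ... | inj₁ x≡next = inj₁ x≡next
    ... | inj₂ x∈fan = inj₂ (proj₂ (∈-filter⁻ (fanEnd? c a b) x∈fan))

  farthest-exposed : ∀ c {a b w} → Inside a b w → Exposed c a b (farthest c a b)
  farthest-exposed c {a} {b} w-in = farthest-inside c w-in , uncovered
    where
    uncovered : ∀ e → page e ≡ c → Nested e a b → ¬ (lo e ≡ a × hi e ≡ b) →
                ¬ Inside (lo e) (hi e) (farthest c a b)
    uncovered e pe (a≼lo , hi≼b) e≢ab (lo≺x , x≺hi) with lo e ≟ a
    ... | yes lo≡a = <⇒≱ x≺hi (≼-farthest e pe lo≡a (≼∧≢⇒≺ hi≼b (e≢ab ∘ (lo≡a ,_))))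
    ... | no lo≢a with farthest-sel c a b
    ...   | inj₁ x≡next =
      <⇒≱ lo≺x (subst (_≼ lo e) (sym x≡next) (next-≼ (≼∧≢⇒≺ a≼lo (lo≢a ∘ sym))))
    ...   | inj₂ (_ , f , pf , refl , hi≡x) = noncrossing f e (trans pf (sym pe))
      (≼∧≢⇒≺ a≼lo (lo≢a ∘ sym) , subst (lo e ≺_) (sym hi≡x) lo≺x , subst (_≺ hi e) (sym hi≡x) x≺hi)

  ≺⇒≢ : ∀ {u v} → u ≺ v → u ≢ v
  ≺⇒≢ u≺v refl = <-irrefl refl u≺v

  opaque
    leftmost rightmost : V
    leftmost = argmin pos 0F vertices
    rightmost = argmax pos 0F vertices

    leftmost-≼ : ∀ w → leftmost ≼ w
    leftmost-≼ w = All.lookup (f[argmin]≤f[xs] {f = pos} 0F vertices) (∈-allFin w)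

    ≼-rightmost : ∀ w → w ≼ rightmost
    ≼-rightmost w = All.lookup (f[xs]≤f[argmax] {f = pos} 0F vertices) (∈-allFin w)

  avoiding : (a b : V) → ∃ λ w → w ≢ a × w ≢ b
  avoiding a b with a ≟ 0F | b ≟ 0F
  ... | no a≢0 | no b≢0 = 0F , a≢0 ∘ sym , b≢0 ∘ sym
  ... | yes refl | _ with b ≟ 1F
  ...   | yes refl = 2F , (λ ()) , (λ ())
  ...   | no b≢1 = 1F , (λ ()) , b≢1 ∘ sym
  avoiding a b | no _ | yes refl with a ≟ 1F
  ...   | yes refl = 2F , (λ ()) , (λ ())
  ...   | no a≢1 = 1F , a≢1 ∘ sym , (λ ())

  outer-inside : ∃ (Inside leftmost rightmost)
  outer-inside =
    let w , w≢min , w≢max = avoiding leftmost rightmost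
    in w , ≼∧≢⇒≺ (leftmost-≼ w) (w≢min ∘ sym) , ≼∧≢⇒≺ (≼-rightmost w) w≢max

  data Kind (e : Fin m) : Set where
    short : (∀ w → ¬ Inside (lo e) (hi e) w) → Kind e
    outer : lo e ≡ leftmost → hi e ≡ rightmost → Kind e
    long  : ¬ (lo e ≡ leftmost × hi e ≡ rightmost) → ∀ x → Exposed (page e) (lo e) (hi e) x → Kind e

  kind : ∀ e → Kind e
  kind e with any? (λ w → (pos (lo e) <? pos w) ×-dec (pos w <? pos (hi e)))
  ... | no none = short (λ w w-in → none (w , w-in))
  ... | yes (_ , w-in) with (lo e ≟ leftmost) ×-dec (hi e ≟ rightmost)
  ...   | yes (lo≡ , hi≡) = outer lo≡ hi≡
  ...   | no not-outer = long not-outer _ (farthest-exposed (page e) w-in)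

  short-hi : ∀ {e f} → (∀ w → ¬ Inside (lo e) (hi e) w) → (∀ w → ¬ Inside (lo f) (hi f) w) →
             lo e ≡ lo f → hi e ≡ hi f
  short-hi {e} {f} short-e short-f lo≡ with <-cmp (pos (hi e)) (pos (hi f))
  ... | tri< he≺hf _ _ = ⊥-elim (short-f (hi e) (subst (_≺ hi e) lo≡ (lo<hi e) , he≺hf))
  ... | tri≈ _ he≡hf _ = pos-injective he≡hf
  ... | tri> _ _ hf≺he = ⊥-elim (short-e (hi f) (subst (_≺ hi f) (sym lo≡) (lo<hi f) , hf≺he))

  exposed-ends : ∀ {e f x} → page e ≡ page f → lo e ≼ lo f →
    Exposed (page e) (lo e) (hi e) x → Exposed (page f) (lo f) (hi f) x → lo e ≡ lo f × hi e ≡ hi f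
  exposed-ends {e} {f} pe le (x-in-e , uncovered-e) (x-in-f , uncovered-f)
    with (lo e ≟ lo f) ×-dec (hi e ≟ hi f)
  ... | yes same = same
  ... | no differ with pos (hi f) ≤? pos (hi e)
  ...   | yes hf≼he =
    ⊥-elim (uncovered-e f (sym pe) (le , hf≼he) (λ (l , h) → differ (sym l , sym h)) x-in-f)
  ...   | no hf⋠he with lo e ≟ lo f
  ...     | yes lo≡ =
    ⊥-elim (uncovered-f e pe (≤-reflexive (cong pos (sym lo≡)) , <⇒≤ (≰⇒> hf⋠he)) differ x-in-e)
  ...     | no lo≢ =
    ⊥-elim (noncrossing e f pe (≼∧≢⇒≺ le lo≢ , <-trans (proj₁ x-in-f) (proj₂ x-in-e) , ≰⇒> hf⋠he))

  slot : ∀ {e} → Kind e → Fin (suc t) × V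
  slot {e} (short _)    = zero , lo e
  slot     (outer _ _)   = zero , rightmost
  slot {e} (long _ x _) = suc (page e) , x

  anchor : Fin t → Fin 3 → V
  anchor c 0F = leftmost
  anchor c 1F = farthest c leftmost rightmost
  anchor c 2F = rightmost

  reserved : Fin t × Fin 3 → Fin (suc t) × V
  reserved (c , i) = suc c , anchor c i

  slot-injective : ∀ {e f} (κ : Kind e) (κ′ : Kind f) → slot κ ≡ slot κ′ → e ≡ f
  slot-injective {e} {f} (short short-e) (short short-f) eq =
    ends-injective e f lo≡ (short-hi short-e short-f lo≡)
    where lo≡ = cong proj₂ eq
  slot-injective {e} (short _) (outer _ _) eq =
    ⊥-elim (<⇒≱ (lo<hi e) (subst (hi e ≼_) (sym (cong proj₂ eq)) (≼-rightmost (hi e))))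
  slot-injective {f = f} (outer _ _) (short _) eq =
    ⊥-elim (<⇒≱ (lo<hi f) (subst (hi f ≼_) (cong proj₂ eq) (≼-rightmost (hi f))))
  slot-injective {e} {f} (outer lo≡ hi≡) (outer lo≡′ hi≡′) _ =
    ends-injective e f (trans lo≡ (sym lo≡′)) (trans hi≡ (sym hi≡′))
  slot-injective {e} {f} (long _ x exp-e) (long _ x′ exp-f) eq
    with Fin-suc-injective (cong proj₁ eq) | cong proj₂ eq
  ... | pe | refl with ≤-total (pos (lo e)) (pos (lo f))
  ...   | inj₁ le = uncurry (ends-injective e f) (exposed-ends pe le exp-e exp-f)
  ...   | inj₂ ge = sym (uncurry (ends-injective f e) (exposed-ends (sym pe) ge exp-f exp-e))
  slot-injective (short _)    (long _ _ _) ()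
  slot-injective (outer _ _)   (long _ _ _) ()
  slot-injective (long _ _ _) (short _)    ()
  slot-injective (long _ _ _) (outer _ _)   ()

  slot≢reserved : ∀ {e} (κ : Kind e) r → slot κ ≢ reserved r
  slot≢reserved (short _)   _ ()
  slot≢reserved (outer _ _) _ ()
  slot≢reserved {e} (long _ x (x-in , _)) (c , 0F) eq =
    ≺⇒≢ (≤-<-trans (leftmost-≼ (lo e)) (proj₁ x-in)) (sym (cong proj₂ eq))
  slot≢reserved {e} (long not-outer x (x-in , _)) (c , 1F) eq =
    proj₂ (farthest-exposed c (proj₂ outer-inside)) e (Fin-suc-injective (cong proj₁ eq))
      (leftmost-≼ (lo e) , ≼-rightmost (hi e)) not-outer
      (subst (Inside (lo e) (hi e)) (cong proj₂ eq) x-in)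
  slot≢reserved {e} (long _ x (x-in , _)) (c , 2F) eq =
    ≺⇒≢ (<-≤-trans (proj₂ x-in) (≼-rightmost (hi e))) (cong proj₂ eq)

  anchor-≺ : ∀ c → Inside leftmost rightmost (farthest c leftmost rightmost)
  anchor-≺ c = farthest-inside c (proj₂ outer-inside)

  anchor-injective : ∀ c i j → anchor c i ≡ anchor c j → i ≡ j
  anchor-injective c 0F 0F _ = refl
  anchor-injective c 1F 1F _ = refl
  anchor-injective c 2F 2F _ = refl
  anchor-injective c 0F 1F eq = ⊥-elim (≺⇒≢ (proj₁ (anchor-≺ c)) eq)
  anchor-injective c 1F 0F eq = ⊥-elim (≺⇒≢ (proj₁ (anchor-≺ c)) (sym eq))
  anchor-injective c 1F 2F eq = ⊥-elim (≺⇒≢ (proj₂ (anchor-≺ c)) eq)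
  anchor-injective c 2F 1F eq = ⊥-elim (≺⇒≢ (proj₂ (anchor-≺ c)) (sym eq))
  anchor-injective c 0F 2F eq = ⊥-elim (≺⇒≢ (uncurry <-trans (anchor-≺ c)) eq)
  anchor-injective c 2F 0F eq = ⊥-elim (≺⇒≢ (uncurry <-trans (anchor-≺ c)) (sym eq))

  reserved-injective : Injective _≡_ _≡_ reserved
  reserved-injective {c , i} {c′ , j} eq with Fin-suc-injective (cong proj₁ eq)
  ... | refl = cong (c ,_) (anchor-injective c i j (cong proj₂ eq))

  encode : Fin m ⊎ (Fin t × Fin 3) → Fin (suc t) × V
  encode (inj₁ e) = slot (kind e)
  encode (inj₂ r) = reserved r

  encode-injective : Injective _≡_ _≡_ encode
  encode-injective {inj₁ e} {inj₁ f} eq = cong inj₁ (slot-injective (kind e) (kind f) eq)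
  encode-injective {inj₁ e} {inj₂ r} eq = ⊥-elim (slot≢reserved (kind e) r eq)
  encode-injective {inj₂ r} {inj₁ f} eq = ⊥-elim (slot≢reserved (kind f) r (sym eq))
  encode-injective {inj₂ r} {inj₂ r′} eq = cong inj₂ (reserved-injective eq)

  edge-bound : m + t * 3 ≤ suc t * (3 + n′)
  edge-bound = ↣⇒≤ ((↔-id _ ⊎-↔ *↔×) ↔-∘ +↔⊎) (↔-sym *↔×) (mk↣ encode-injective)

infix 4 _≐_
_≐_ : {A : Set} → A × A → A × A → Set
(u , v) ≐ (x , y) = (u ≡ x × v ≡ y) ⊎ (u ≡ y × v ≡ x)

≐-sym : {A : Set} {p q : A × A} → p ≐ q → q ≐ p
≐-sym (inj₁ (u≡x , v≡y)) = inj₁ (sym u≡x , sym v≡y)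
≐-sym (inj₂ (u≡y , v≡x)) = inj₂ (sym v≡x , sym u≡y)

≐-trans : {A : Set} {p q r : A × A} → p ≐ q → q ≐ r → p ≐ r
≐-trans (inj₁ (refl , refl)) q≐r = q≐r
≐-trans (inj₂ (refl , refl)) (inj₁ (refl , refl)) = inj₂ (refl , refl)
≐-trans (inj₂ (refl , refl)) (inj₂ (refl , refl)) = inj₁ (refl , refl)

≐-resp : ∀ {A : Set} {R : A → A → Set} → Symmetric R →
         {p q : A × A} → p ≐ q → uncurry R q → uncurry R p
≐-resp R-sym {_ , _} {_ , _} (inj₁ (refl , refl)) r = r
≐-resp R-sym {_ , _} {_ , _} (inj₂ (refl , refl)) r = R-sym r

pad-pages : ∀ {n s t} {G : Graph n} → s ≤ t → BookEmbedding G s → BookEmbedding G t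
pad-pages s≤t E = record
  { pos      = pos
  ; pos-inj  = pos-inj
  ; page     = λ u v → inject≤ (page u v) s≤t
  ; page-sym = λ u v → cong (λ p → inject≤ p s≤t) (page-sym u v)
  ; noCross  = λ u v x y uv xy same → noCross u v x y uv xy (inject≤-injective s≤t s≤t _ _ same)
  }
  where open BookEmbedding E

book-edge-bound : ∀ {n′ t m} {G : Graph (3 + n′)} → Symmetric G → BookEmbedding G t →
  (ends : Fin m → Fin (3 + n′) × Fin (3 + n′)) →
  (∀ e → uncurry G (ends e)) → (∀ e → uncurry _≢_ (ends e)) → (∀ e f → ends e ≐ ends f → e ≡ f) →
  m + t * 3 ≤ suc t * (3 + n′)
book-edge-bound {n′} {G = G} G-sym E ends is-edge loopless distinct =
  NoncrossingEdgeBound.edge-bound pos pos-inj lo hi lo<hi ends-injective page′ noncrossing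
  where
  open BookEmbedding E
  V = Fin (3 + n′)

  orient : V × V → V × V
  orient (u , v) with pos u <? pos v
  ... | yes _ = u , v
  ... | no _  = v , u

  orient-≐ : ∀ uv → orient uv ≐ uv
  orient-≐ (u , v) with pos u <? pos v
  ... | yes _ = inj₁ (refl , refl)
  ... | no _  = inj₂ (refl , refl)

  orient-< : ∀ uv → uncurry _≢_ uv → pos (proj₁ (orient uv)) < pos (proj₂ (orient uv))
  orient-< (u , v) u≢v with pos u <? pos v
  ... | yes u<v = u<v
  ... | no u≮v  = ≤∧≢⇒< (≮⇒≥ u≮v) (u≢v ∘ sym ∘ pos-inj)

  lo hi : _ → V
  lo e = proj₁ (orient (ends e))
  hi e = proj₂ (orient (ends e))

  lo<hi : ∀ e → pos (lo e) < pos (hi e)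
  lo<hi e = orient-< (ends e) (loopless e)

  ends-injective : ∀ e f → lo e ≡ lo f → hi e ≡ hi f → e ≡ f
  ends-injective e f lo≡ hi≡ =
    distinct e f (≐-trans (≐-sym (orient-≐ (ends e)))
                   (subst (_≐ ends f) (sym (cong₂ _,_ lo≡ hi≡)) (orient-≐ (ends f))))

  oriented-edge : ∀ e → G (lo e) (hi e)
  oriented-edge e = ≐-resp {R = G} G-sym (orient-≐ (ends e)) (is-edge e)

  page′ : _ → _
  page′ e = page (lo e) (hi e)

  noncrossing : ∀ e f → page′ e ≡ page′ f →
    ¬ (pos (lo e) < pos (lo f) × pos (lo f) < pos (hi e) × pos (hi e) < pos (hi f))
  noncrossing e f = noCross (lo e) (hi e) (lo f) (hi f) (oriented-edge e) (oriented-edge f)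

≡ᵇ-refl : ∀ m → (m ≡ᵇ m) ≡ true
≡ᵇ-refl m = dec-true (m ≟ℕ m) refl

≢⇒≡ᵇ≡false : ∀ {m n} → m ≢ n → (m ≡ᵇ n) ≡ false
≢⇒≡ᵇ≡false {m} {n} = dec-false (m ≟ℕ n)

<⇒≡ᵇ≡false : ∀ {m n} → m < n → (m ≡ᵇ n) ≡ false
<⇒≡ᵇ≡false = ≢⇒≡ᵇ≡false ∘ <⇒≢

>⇒≡ᵇ≡false : ∀ {m n} → n < m → (m ≡ᵇ n) ≡ false
>⇒≡ᵇ≡false = ≢⇒≡ᵇ≡false ∘ >⇒≢

parity-suc≢ : ∀ i → parity (suc i) ≢ parity i
parity-suc≢ i eq = p≢p⁻¹ (parity (suc i)) (trans eq (sym (suc-homo-⁻¹ i)))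

pattern rim    = 0F
pattern chord  = 1F
pattern pSpoke = 2F
pattern qSpoke = 3F

module ExtendedWheel (k : ℕ) where

  M : ℕ
  M = 2 * k

  index : ∀ {a b} → XWDir k a b → Fin 4 × ℕ
  index (cyc {i} _)   = rim , i
  index cycWrap       = rim , M ∸ 1
  index (chd {i} _)   = chord , i
  index chdWrap₁      = chord , M ∸ 2
  index chdWrap₂      = chord , M ∸ 1
  index (poleP {i} _) = pSpoke , i
  index (poleQ {i} _) = qSpoke , i

  -- decode inverts index on the unordered pair of ends (decode-index); on non-edges it is junk.
  decodeOrdered : ℕ → ℕ → Fin 4 × ℕ
  decodeOrdered a b =
    if b ≡ᵇ suc M then qSpoke , a else
    if b ≡ᵇ M then pSpoke , a else
    if b ≡ᵇ suc a then rim , a else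
    if b ≡ᵇ 2 + a then chord , a else
    if (a ≡ᵇ 0) ∧ (b ≡ᵇ M ∸ 1) then rim , b else
    chord , b

  decode : ℕ → ℕ → Fin 4 × ℕ
  decode a b = decodeOrdered (a ⊓ b) (a ⊔ b)

  decode-comm : ∀ a b → decode a b ≡ decode b a
  decode-comm a b = cong₂ decodeOrdered (⊓-comm a b) (⊔-comm a b)

  decode-≤ : ∀ {a b} → a ≤ b → decode a b ≡ decodeOrdered a b
  decode-≤ a≤b = cong₂ decodeOrdered (m≤n⇒m⊓n≡m a≤b) (m≤n⇒m⊔n≡n a≤b)

  decode-≥ : ∀ {a b} → b ≤ a → decode a b ≡ decodeOrdered b a
  decode-≥ b≤a = cong₂ decodeOrdered (m≥n⇒m⊓n≡n b≤a) (m≥n⇒m⊔n≡m b≤a)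

  -- The spine order q, v₁, …, v₂ₖ, p.
  position : ℕ → ℕ
  position a = if a ≡ᵇ suc M then 0 else suc a

  position-q : position (suc M) ≡ 0
  position-q rewrite ≡ᵇ-refl M = refl

  position-≢ : ∀ {a} → a ≢ suc M → position a ≡ suc a
  position-≢ a≢ rewrite ≢⇒≡ᵇ≡false a≢ = refl

  position-≤ : ∀ {a} → a ≤ M → position a ≡ suc a
  position-≤ a≤M = position-≢ (<⇒≢ (s≤s a≤M))

  position-injective : ∀ {a b} → position a ≡ position b → a ≡ b
  position-injective {a} {b} eq with a ≟ℕ suc M | b ≟ℕ suc M
  ... | yes refl | yes refl = refl
  ... | yes refl | no b≢ = ⊥-elim (0≢1+n (trans (sym position-q) (trans eq (position-≢ b≢))))
  ... | no a≢ | yes refl = ⊥-elim (0≢1+n (trans (sym position-q) (trans (sym eq) (position-≢ a≢))))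
  ... | no a≢ | no b≢ = suc-injective (trans (sym (position-≢ a≢)) (trans eq (position-≢ b≢)))

  chordPage : Parity → Fin 4
  chordPage 0ℙ = 2F
  chordPage 1ℙ = 3F

  bookPage : Fin 4 × ℕ → Fin 4
  bookPage (rim , i)     = if i ≡ᵇ M ∸ 1 then 2F else 0F
  bookPage (chord , i)   = chordPage (parity i)
  bookPage (pSpoke , _)  = 1F
  bookPage (qSpoke , _) = 0F

  Chord : Parity → ℕ → ℕ → Set
  Chord r x y = Σ ℕ λ i → x ≡ suc i × y ≡ 3 + i × parity i ≡ r × y ≤ M

  PageShape : Fin 4 → ℕ → ℕ → Set
  PageShape 0F x y = x ≡ 0 ⊎ y ≡ suc x
  PageShape 1F x y = y ≡ suc M
  PageShape 2F x y = Chord 0ℙ x y ⊎ (x ≡ 1 × M ≤ suc y)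
  PageShape 3F x y = Chord 1ℙ x y ⊎ (x ≡ 2 × y ≡ M)

  chord-shape : ∀ r {x y} → Chord r x y → PageShape (chordPage r) x y
  chord-shape 0ℙ = inj₁
  chord-shape 1ℙ = inj₁

  Drawn : Fin 4 → ℕ → ℕ → Set
  Drawn c x y = (x < y × PageShape c x y) ⊎ (y < x × PageShape c y x)

  Drawn-swap : ∀ {c x y} → Drawn c x y → Drawn c y x
  Drawn-swap (inj₁ d) = inj₂ d
  Drawn-swap (inj₂ d) = inj₁ d

  Drawn-< : ∀ {c x y} → Drawn c x y → x < y → PageShape c x y
  Drawn-< (inj₁ (_ , s)) _ = s
  Drawn-< (inj₂ (y<x , _)) x<y = ⊥-elim (<-asym x<y y<x)

  parity-M : parity M ≡ 0ℙ
  parity-M = *-homo-* 2 k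

  chords-noncrossing : ∀ {r u v x y} → Chord r u v → Chord r x y → ¬ (u < x × x < v × v < y)
  chords-noncrossing (i , refl , refl , pi , _) (j , refl , refl , pj , _) (s≤s i<j , s≤s j<i+2 , _)
    with ≤-antisym i<j (≤-pred j<i+2)
  ... | refl = parity-suc≢ i (trans pj (sym pi))

  shape-noncrossing : ∀ c {u v x y} → PageShape c u v → PageShape c x y → ¬ (u < x × x < v × v < y)
  shape-noncrossing 0F _ (inj₁ refl) (() , _)
  shape-noncrossing 0F _ (inj₂ refl) (_ , x<v , v<y) = <⇒≱ x<v (≤-pred v<y)
  shape-noncrossing 1F refl refl (_ , _ , v<y) = <-irrefl refl v<y
  shape-noncrossing 2F (inj₁ ch) (inj₁ ch′) = chords-noncrossing ch ch′
  shape-noncrossing 2F (inj₁ (_ , refl , _)) (inj₂ (refl , _)) (s≤s () , _)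
  shape-noncrossing 2F (inj₂ (refl , _)) (inj₂ (refl , _)) (1<1 , _) = <-irrefl refl 1<1
  shape-noncrossing 2F (inj₂ (_ , M≤v+1)) (inj₁ (i , _ , refl , pi , y≤M)) (_ , _ , v<y)
    with ≤-antisym y≤M (≤-trans M≤v+1 v<y)
  ... | y≡M = parity-suc≢ i (trans (cong parity y≡M) (trans parity-M (sym pi)))
  shape-noncrossing 3F (inj₁ ch) (inj₁ ch′) = chords-noncrossing ch ch′
  shape-noncrossing 3F (inj₁ (0 , refl , _ , () , _)) (inj₂ (refl , _))
  shape-noncrossing 3F (inj₁ (suc _ , refl , _)) (inj₂ (refl , _)) (s≤s (s≤s ()) , _)
  shape-noncrossing 3F (inj₂ (refl , refl)) (inj₁ (_ , _ , _ , _ , y≤M)) (_ , _ , M<y) = <⇒≱ M<y y≤M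
  shape-noncrossing 3F (inj₂ (refl , _)) (inj₂ (refl , _)) (2<2 , _) = <-irrefl refl 2<2

  module _ (3≤k : 3 ≤ k) where

    6≤M : 6 ≤ M
    6≤M = *-monoʳ-≤ 2 3≤k

    M∸1+1 : suc (M ∸ 1) ≡ M
    M∸1+1 = m+[n∸m]≡n {1} (≤-trans (s≤s z≤n) 6≤M)

    M∸2+2 : suc (suc (M ∸ 2)) ≡ M
    M∸2+2 = m+[n∸m]≡n {2} (≤-trans (s≤s (s≤s z≤n)) 6≤M)

    M∸1<M : M ∸ 1 < M
    M∸1<M = ≤-reflexive M∸1+1

    M∸2<M∸1 : M ∸ 2 < M ∸ 1
    M∸2<M∸1 = ≤-reflexive (suc-injective (trans M∸2+2 (sym M∸1+1)))

    M∸2<M : M ∸ 2 < M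
    M∸2<M = <-trans M∸2<M∸1 M∸1<M

    2<M∸2 : 2 < M ∸ 2
    2<M∸2 = ≤-trans (n≤1+n 3) (∸-monoˡ-≤ 2 6≤M)

    1<M∸2 : 1 < M ∸ 2
    1<M∸2 = <-trans (n<1+n 1) 2<M∸2

    1<M∸1 : 1 < M ∸ 1
    1<M∸1 = <-trans 1<M∸2 M∸2<M∸1

    2<M∸1 : 2 < M ∸ 1
    2<M∸1 = <-trans 2<M∸2 M∸2<M∸1

    3<M∸1 : 3 < M ∸ 1
    3<M∸1 = ≤-trans (s≤s 2<M∸2) M∸2<M∸1

    decode-index : ∀ {a b} (d : XWDir k a b) → decode a b ≡ index d
    decode-index (cyc {i} i+1<M)
      rewrite decode-≤ (n≤1+n i) | <⇒≡ᵇ≡false (m<n⇒m<1+n i+1<M) | <⇒≡ᵇ≡false i+1<M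
            | ≡ᵇ-refl i = refl
    decode-index cycWrap
      rewrite decode-≥ (z≤n {M ∸ 1}) | <⇒≡ᵇ≡false (m<n⇒m<1+n M∸1<M) | <⇒≡ᵇ≡false M∸1<M
            | >⇒≡ᵇ≡false 1<M∸1 | >⇒≡ᵇ≡false 2<M∸1 | ≡ᵇ-refl (M ∸ 1) = refl
    decode-index (chd {i} i+2<M)
      rewrite decode-≤ (≤-trans (n≤1+n i) (n≤1+n (suc i))) | <⇒≡ᵇ≡false (m<n⇒m<1+n i+2<M)
            | <⇒≡ᵇ≡false i+2<M | >⇒≡ᵇ≡false (n<1+n i) | ≡ᵇ-refl i = refl
    decode-index chdWrap₁
      rewrite decode-≥ (z≤n {M ∸ 2}) | <⇒≡ᵇ≡false (m<n⇒m<1+n M∸2<M) | <⇒≡ᵇ≡false M∸2<M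
            | >⇒≡ᵇ≡false 1<M∸2 | >⇒≡ᵇ≡false 2<M∸2 | <⇒≡ᵇ≡false M∸2<M∸1 = refl
    decode-index chdWrap₂
      rewrite decode-≥ (<⇒≤ 1<M∸1) | <⇒≡ᵇ≡false (m<n⇒m<1+n M∸1<M) | <⇒≡ᵇ≡false M∸1<M
            | >⇒≡ᵇ≡false 2<M∸1 | >⇒≡ᵇ≡false 3<M∸1 = refl
    decode-index (poleP {i} i<M)
      rewrite decode-≤ (<⇒≤ i<M) | <⇒≡ᵇ≡false (n<1+n M) | ≡ᵇ-refl M = refl
    decode-index (poleQ {i} i<M)
      rewrite decode-≤ (<⇒≤ (m<n⇒m<1+n i<M)) | ≡ᵇ-refl M = refl

    parity-M∸2 : parity (M ∸ 2) ≡ 0ℙ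
    parity-M∸2 = trans (cong parity M∸2+2) parity-M

    parity-M∸1 : parity (M ∸ 1) ≡ 1ℙ
    parity-M∸1 =
      trans (sym (suc-homo-⁻¹ (M ∸ 1))) (cong _⁻¹ (trans (cong parity M∸1+1) parity-M))

    edge-drawn : ∀ {a b} (d : XWDir k a b) → Drawn (bookPage (index d)) (position a) (position b)
    edge-drawn (cyc {i} i+1<M)
      rewrite position-≤ (<⇒≤ (<-trans (n<1+n i) i+1<M)) | position-≤ (<⇒≤ i+1<M)
            | <⇒≡ᵇ≡false (≤-pred (subst (suc i <_) (sym M∸1+1) i+1<M)) =
      inj₁ (n<1+n _ , inj₂ refl)
    edge-drawn cycWrap
      rewrite position-≤ (<⇒≤ M∸1<M) | M∸1+1 | position-≤ (z≤n {M}) | ≡ᵇ-refl (M ∸ 1) =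
      inj₂ (<-trans 1<M∸1 M∸1<M , inj₂ (refl , n≤1+n M))
    edge-drawn (chd {i} i+2<M)
      rewrite position-≤ (<⇒≤ (<-trans (n<1+n i) (<-trans (n<1+n (suc i)) i+2<M)))
            | position-≤ (<⇒≤ i+2<M) =
      inj₁ (m<n⇒m<1+n (n<1+n _) , chord-shape (parity i) (i , refl , refl , refl , i+2<M))
    edge-drawn chdWrap₁
      rewrite parity-M∸2 | position-≤ (<⇒≤ M∸2<M) | position-≤ (z≤n {M}) =
      inj₂ (s≤s (<⇒≤ 1<M∸2) , inj₂ (refl , ≤-reflexive (sym M∸2+2)))
    edge-drawn chdWrap₂
      rewrite parity-M∸1 | position-≤ (<⇒≤ M∸1<M) | M∸1+1 | position-≤ (<⇒≤ (<-trans 1<M∸1 M∸1<M)) =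
      inj₂ (<-trans 2<M∸1 M∸1<M , inj₂ (refl , refl))
    edge-drawn (poleP {i} i<M) rewrite position-≤ (<⇒≤ i<M) | position-≤ (≤-refl {M}) =
      inj₁ (s≤s i<M , refl)
    edge-drawn (poleQ {i} i<M) rewrite position-≤ (<⇒≤ i<M) | position-q =
      inj₂ (s≤s z≤n , inj₁ refl)

    Drawn-≢ : ∀ {c x y} → Drawn c x y → x ≢ y
    Drawn-≢ (inj₁ (x<y , _)) = <⇒≢ x<y
    Drawn-≢ (inj₂ (y<x , _)) = >⇒≢ y<x

    dir-loopless : ∀ {a b} → XWDir k a b → a ≢ b
    dir-loopless d a≡b = Drawn-≢ (edge-drawn d) (cong position a≡b)

    label : Fin (M + 2) → Fin (M + 2) → Fin 4 × ℕ
    label u v = decode (toℕ u) (toℕ v)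

    xw-drawn : ∀ {u v} → XW k u v → Drawn (bookPage (label u v)) (position (toℕ u)) (position (toℕ v))
    xw-drawn (inj₁ d) rewrite decode-index d = edge-drawn d
    xw-drawn {u} {v} (inj₂ d) rewrite decode-comm (toℕ u) (toℕ v) | decode-index d =
      Drawn-swap (edge-drawn d)

    xw-embedding : BookEmbedding (XW k) 4
    xw-embedding = record
      { pos      = position ∘ toℕ
      ; pos-inj  = toℕ-injective ∘ position-injective
      ; page     = λ u v → bookPage (label u v)
      ; page-sym = λ u v → cong bookPage (decode-comm (toℕ u) (toℕ v))
      ; noCross  = λ u v x y uv xy same (u<x , x<v , v<y) →
          shape-noncrossing _ (Drawn-< (xw-drawn uv) (<-trans u<x x<v))
            (subst (λ c → PageShape c _ _) (sym same) (Drawn-< (xw-drawn xy) (<-trans x<v v<y)))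
            (u<x , x<v , v<y)
      }

    record EdgeAt (g : Fin 4) (i : ℕ) : Set where
      constructor ⟨_,_⟩
      field
        {a b}   : ℕ
        dir     : XWDir k a b
        indexed : index dir ≡ (g , i)

    edge-at : ∀ g {i} → i < M → EdgeAt g i
    edge-at rim {i} i<M with suc i <? M
    ... | yes i+1<M = ⟨ cyc i+1<M , refl ⟩
    ... | no i+1≮M  =
      ⟨ cycWrap , cong (λ j → rim , j ∸ 1) (sym (≤-antisym i<M (≮⇒≥ i+1≮M))) ⟩
    edge-at chord {i} i<M with 2 + i <? M | suc i <? M
    ... | yes i+2<M | _ = ⟨ chd i+2<M , refl ⟩
    ... | no i+2≮M | yes i+1<M =
      ⟨ chdWrap₁ , cong (λ j → chord , j ∸ 2) (sym (≤-antisym i+1<M (≮⇒≥ i+2≮M))) ⟩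
    ... | no _ | no i+1≮M =
      ⟨ chdWrap₂ , cong (λ j → chord , j ∸ 1) (sym (≤-antisym i<M (≮⇒≥ i+1≮M))) ⟩
    edge-at pSpoke i<M = ⟨ poleP i<M , refl ⟩
    edge-at qSpoke i<M = ⟨ poleQ i<M , refl ⟩

    dir-≤ : ∀ {a b} → XWDir k a b → a ≤ suc M × b ≤ suc M
    dir-≤ (cyc {i} i+1<M) = m<n⇒m≤1+n (<-trans (n<1+n i) i+1<M) , m<n⇒m≤1+n i+1<M
    dir-≤ cycWrap         = m<n⇒m≤1+n M∸1<M , z≤n
    dir-≤ (chd {i} i+2<M) =
      m<n⇒m≤1+n (<-trans (n<1+n i) (<-trans (n<1+n (suc i)) i+2<M)) , m<n⇒m≤1+n i+2<M
    dir-≤ chdWrap₁        = m<n⇒m≤1+n M∸2<M , z≤n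
    dir-≤ chdWrap₂        = m<n⇒m≤1+n M∸1<M , s≤s z≤n
    dir-≤ (poleP i<M)     = m<n⇒m≤1+n i<M , n≤1+n M
    dir-≤ (poleQ i<M)     = m<n⇒m≤1+n i<M , ≤-refl

    ≤1+M⇒<M+2 : ∀ {a} → a ≤ suc M → a < M + 2
    ≤1+M⇒<M+2 {a} a≤1+M = subst (a <_) (+-comm 2 M) (s≤s a≤1+M)

    vertex : ∀ {a} → a ≤ suc M → Fin (M + 2)
    vertex a≤1+M = fromℕ< (≤1+M⇒<M+2 a≤1+M)

    toℕ-vertex : ∀ {a} (a≤1+M : a ≤ suc M) → toℕ (vertex a≤1+M) ≡ a
    toℕ-vertex a≤1+M = toℕ-fromℕ< (≤1+M⇒<M+2 a≤1+M)

    open EdgeAt using (dir; indexed)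

    edge-of : (j : Fin (4 * M)) → EdgeAt (proj₁ (remQuot {4} M j)) (toℕ (proj₂ (remQuot {4} M j)))
    edge-of j = let g , i = remQuot {4} M j in edge-at g (toℕ<n i)

    edges : Fin (4 * M) → Fin (M + 2) × Fin (M + 2)
    edges j = vertex (proj₁ (dir-≤ (dir (edge-of j)))) , vertex (proj₂ (dir-≤ (dir (edge-of j))))

    edges-toℕ : ∀ j →
      toℕ (proj₁ (edges j)) ≡ EdgeAt.a (edge-of j) × toℕ (proj₂ (edges j)) ≡ EdgeAt.b (edge-of j)
    edges-toℕ j = toℕ-vertex (proj₁ bounds) , toℕ-vertex (proj₂ bounds)
      where bounds = dir-≤ (dir (edge-of j))

    edges-XW : ∀ j → uncurry (XW k) (edges j)
    edges-XW j =
      inj₁ (subst₂ (XWDir k) (sym (proj₁ (edges-toℕ j))) (sym (proj₂ (edges-toℕ j))) (dir (edge-of j)))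

    edges-loopless : ∀ j → uncurry _≢_ (edges j)
    edges-loopless j u≡v = dir-loopless (dir (edge-of j))
      (trans (sym (proj₁ (edges-toℕ j))) (trans (cong toℕ u≡v) (proj₂ (edges-toℕ j))))

    label-edges : ∀ j → uncurry label (edges j) ≡ (proj₁ (remQuot {4} M j) , toℕ (proj₂ (remQuot {4} M j)))
    label-edges j rewrite proj₁ (edges-toℕ j) | proj₂ (edges-toℕ j) =
      trans (decode-index (dir (edge-of j))) (indexed (edge-of j))

    label-≐ : ∀ {p q} → p ≐ q → uncurry label p ≡ uncurry label q
    label-≐ {_ , _} {_ , _} (inj₁ (refl , refl)) = refl
    label-≐ {u , v} {_ , _} (inj₂ (refl , refl)) = decode-comm (toℕ u) (toℕ v)

    edges-distinct : ∀ j j′ → edges j ≐ edges j′ → j ≡ j′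
    edges-distinct j j′ same = Injection.injective (↔⇒↣ (*↔× {4} {M}))
      (cong₂ _,_ (cong proj₁ slot≡) (toℕ-injective (cong proj₂ slot≡)))
      where slot≡ = trans (sym (label-edges j)) (trans (label-≐ same) (label-edges j′))

xw-symmetric : ∀ k → Symmetric (XW k)
xw-symmetric k = swap

xw-not-three-page : ∀ k → 3 ≤ k → ¬ BookEmbedding (XW k) 3
xw-not-three-page k 3≤k@(s≤s (s≤s (s≤s _))) E = 1+n≰n (+-cancelˡ-≤ (4 * M) 9 8 4M+9≤4M+8)
  where
  open ExtendedWheel k
  4M+9≤4M+8 : 4 * M + 9 ≤ 4 * M + 8
  4M+9≤4M+8 = subst (4 * M + 9 ≤_) (*-distribˡ-+ 4 M 2)
    (book-edge-bound (xw-symmetric k) E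
       (edges 3≤k) (edges-XW 3≤k) (edges-loopless 3≤k) (edges-distinct 3≤k))

corollary3 : (k : ℕ) → 3 ≤ k → BookThickness (XW k) 4
corollary3 k 3≤k =
  ExtendedWheel.xw-embedding k 3≤k ,
  λ s E → ≮⇒≥ (λ s<4 → xw-not-three-page k 3≤k (pad-pages (≤-pred s<4) E))
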